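{- Let $p$ be an odd prime and $f(x)\in\mathbb{Z}_p[x]$ a polynomial of degree $m\geq1$, with $d=\mathrm{Exp}(f(x))$ and associated polynomial $f_d(x)$. If $d$ is odd, then $f(x)$ is reflexible if and only if $f_d(x)$ is reflexible, and in that case $f(x)$ and $f_d(x)$ have the same reflexibility type. If $d$ is even, then $f(x)$ is reflexible if and only if $f_d(x)$ is type-1 reflexible. In particular, every reflexible polynomial of positive degree is weakly reflexible, and conversely a weakly reflexible $f(x)$ is reflexible unless $d$ is even and $f_d(x)$ is type-2 reflexible.
   Context: A nonzero $f(x)=\alpha_0+\dots+\alpha_mx^m$ of degree $m$ is type-1 reflexible if $\lambda\alpha_{m-i}=\alpha_i$ for all $i$ and some $\lambda\in\mathbb{Z}_p^*$, type-2 reflexible if $\lambda\alpha_{m-i}=(-1)^i\alpha_i$ for all $i$ and some $\lambda\in\mathbb{Z}_p^*$; reflexible means of type 1 or 2. $\mathrm{Exp}(f(x))$ is the largest positive integer $k$ such that $f(x)=F(x^k)$ for some $F\in\mathbb{Z}_p[x]$, and with $d=\mathrm{Exp}(f(x))$ the associated polynomial $f_d$ is defined by $f(x)=f_d(x^d)$. A nonconstant polynomial is weakly reflexible if its associated polynomial is reflexible. -}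

module Defs where

open import Data.Nat as ℕ using (ℕ; _≤_; _<_; _∸_; NonZero; >-nonZero)
import Data.Nat.Divisibility as ℕD
open import Data.Integer as ℤ using (ℤ; +_; -1ℤ)
open import Data.Integer.Divisibility using (_∣_)
open import Data.Product using (_×_; _,_; ∃-syntax)
open import Data.Sum using (_⊎_)
open import Relation.Nullary using (¬_)

-- Elements of ℤ_p are represented by integer lifts; equality in ℤ_p is
-- congruence modulo p.
infix 4 _≡_[mod_]
_≡_[mod_] : ℤ → ℤ → ℕ → Set
a ≡ b [mod p ] = (+ p) ∣ (a ℤ.- b)

Unit : ℕ → ℤ → Set
Unit p l = ¬ ((+ p) ∣ l)

-- A polynomial f(x) = Σ α_i x^i in ℤ_p[x] is given by its coefficient
-- sequence α : ℕ → ℤ (lifts to ℤ).  It has degree m iff α_m ≠ 0 in ℤ_p and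
-- α_i = 0 in ℤ_p for all i > m.
HasDegree : ℕ → ℕ → (ℕ → ℤ) → Set
HasDegree p m α = Unit p (α m) × (∀ i → m < i → (+ p) ∣ α i)

Type1 : ℕ → ℕ → (ℕ → ℤ) → Set
Type1 p m α = ∃[ l ] (Unit p l × (∀ i → i ≤ m → l ℤ.* α (m ∸ i) ≡ α i [mod p ]))

Type2 : ℕ → ℕ → (ℕ → ℤ) → Set
Type2 p m α = ∃[ l ] (Unit p l × (∀ i → i ≤ m → l ℤ.* α (m ∸ i) ≡ (-1ℤ ℤ.^ i) ℤ.* α i [mod p ]))

Reflexible : ℕ → ℕ → (ℕ → ℤ) → Set
Reflexible p m α = Type1 p m α ⊎ Type2 p m α

-- f(x) = F(x^k) for some F ∈ ℤ_p[x]  iff  every nonzero coefficient α_i has k ∣ i.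
IsPolyIn-x^ : ℕ → (ℕ → ℤ) → ℕ → Set
IsPolyIn-x^ p α k = ∀ i → Unit p (α i) → k ℕD.∣ i

IsExp : ℕ → (ℕ → ℤ) → ℕ → Set
IsExp p α d = 1 ≤ d × IsPolyIn-x^ p α d × (∀ k → 1 ≤ k → IsPolyIn-x^ p α k → k ≤ d)

-- The associated polynomial f_d, defined by f(x) = f_d(x^d): its j-th
-- coefficient is α_{d j}.
assoc : (ℕ → ℤ) → ℕ → (ℕ → ℤ)
assoc α d j = α (d ℕ.* j)

assocDeg : ∀ p α d → ℕ → IsExp p α d → ℕ
assocDeg p α d m (d≥1 , _) = ℕ._/_ m d {{>-nonZero d≥1}}

WeaklyReflexible : ∀ p m α d → IsExp p α d → Set
WeaklyReflexible p m α d e = Reflexible p (assocDeg p α d m e) (assoc α d)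

-- Since f(x) = f_d(x^d), the coefficients of f at positions d j are those of
-- f_d at j and all others vanish; in particular d divides m = deg f.  A
-- reflexibility condition at position d j of f is therefore the same condition
-- at position j of f_d, and off the multiples of d it holds trivially.  The
-- only twist is the sign: (-1)^(d j) equals (-1)^j for odd d, but equals 1 for
-- even d, so type 2 for f corresponds to type 1 for f_d when d is even.
module Submission where

open import Defs
open import Data.Nat using (ℕ; _≤_)
open import Relation.Binary.PropositionalEquality using (_≢_)
open import Data.Nat.Divisibility using (_∣_)
open import Data.Nat.Primality using (Prime)
open import Data.Integer using (ℤ)
open import Data.Product using (_×_)
open import Function.Bundles using (_⇔_)
open import Relation.Nullary using (¬_)

open import Data.Nat as ℕ using (zero; suc; _*_; _∸_; NonZero)
import Data.Nat.Properties as ℕ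
open import Data.Nat.Divisibility
  using (_∣?_; divides; ∣-refl; ∣1⇒≡1; ∣m+n∣m⇒∣n; ∣m∣n⇒∣m+n; m∣m*n)
open import Data.Nat.DivMod using (m*[n/m]≡n)
open import Data.Integer as ℤ using (+_; -1ℤ; 1ℤ; _^_)
import Data.Integer.Properties as ℤ
import Data.Integer.Divisibility as ℤᵤ
import Data.Integer.Divisibility.Signed as ℤₛ
open import Data.Product using (_,_; ∃-syntax)
open import Data.Sum using (inj₁; inj₂; [_,_])
open import Data.Sum.Function.Propositional using (_⊎-⇔_)
open import Function using (_∘_)
open import Function.Bundles using (mk⇔; module Equivalence)
open import Relation.Binary.PropositionalEquality
  using (_≡_; refl; sym; trans; cong; subst; subst₂)
open import Relation.Nullary using (yes; no; contradiction)
open import Relation.Nullary.Decidable using (decidable-stable)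

open Equivalence using (to; from)

¬Unit⇒∣ : ∀ p x → ¬ Unit p x → + p ℤᵤ.∣ x
¬Unit⇒∣ p x = decidable-stable (p ∣? ℤ.∣ x ∣)

∣m∣n⇒∣m-n : ∀ {k m n} → k ℤᵤ.∣ m → k ℤᵤ.∣ n → k ℤᵤ.∣ m ℤ.- n
∣m∣n⇒∣m-n {k} {m} {n} k∣m k∣n = ℤₛ.∣⇒∣ᵤ {k} {m ℤ.- n}
  (ℤₛ.∣m∣n⇒∣m-n {k} {m} {n} (ℤₛ.∣ᵤ⇒∣ {k} {m} k∣m) (ℤₛ.∣ᵤ⇒∣ {k} {n} k∣n))

∣n⇒∣m*n : ∀ {k} m {n} → k ℤᵤ.∣ n → k ℤᵤ.∣ m ℤ.* n
∣n⇒∣m*n {k} m {n} k∣n = ℤₛ.∣⇒∣ᵤ {k} {m ℤ.* n} (ℤₛ.∣n⇒∣m*n {k} m {n} (ℤₛ.∣ᵤ⇒∣ {k} {n} k∣n))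

-1^[2+n]≡-1^n : ∀ n → -1ℤ ^ (2 ℕ.+ n) ≡ -1ℤ ^ n
-1^[2+n]≡-1^n n = trans (ℤ.-1*i≡-i _) (trans (cong ℤ.-_ (ℤ.-1*i≡-i _)) (ℤ.neg-involutive _))

-1^-even : ∀ n → 2 ∣ n → -1ℤ ^ n ≡ 1ℤ
-1^-even zero          _   = refl
-1^-even (suc zero)    2∣1 = contradiction (∣1⇒≡1 2∣1) λ ()
-1^-even (suc (suc n)) 2∣n+2 =
  trans (-1^[2+n]≡-1^n n) (-1^-even n (∣m+n∣m⇒∣n 2∣n+2 ∣-refl))

-1^-odd : ∀ n → ¬ 2 ∣ n → -1ℤ ^ n ≡ -1ℤ
-1^-odd zero          2∤0   = contradiction (divides 0 refl) 2∤0
-1^-odd (suc zero)    _     = refl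
-1^-odd (suc (suc n)) 2∤n+2 =
  trans (-1^[2+n]≡-1^n n) (-1^-odd n (λ 2∣n → 2∤n+2 (∣m∣n⇒∣m+n ∣-refl 2∣n)))

-- Type1 and Type2 are the instances τ = type1Twist and τ = type2Twist, definitionally.
ReflexibleWith : (ℕ → ℤ → ℤ) → ℕ → ℕ → (ℕ → ℤ) → Set
ReflexibleWith τ p m α =
  ∃[ l ] (Unit p l × (∀ i → i ≤ m → l ℤ.* α (m ∸ i) ≡ τ i (α i) [mod p ]))

type1Twist : ℕ → ℤ → ℤ
type1Twist _ x = x

type2Twist : ℕ → ℤ → ℤ
type2Twist i x = (-1ℤ ^ i) ℤ.* x

PreservesMultiplesOf : ℕ → (ℕ → ℤ → ℤ) → Set
PreservesMultiplesOf p τ = ∀ i x → + p ℤᵤ.∣ x → + p ℤᵤ.∣ τ i x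

type1Twist-∣ : ∀ p → PreservesMultiplesOf p type1Twist
type1Twist-∣ _ _ _ p∣x = p∣x

type2Twist-∣ : ∀ p → PreservesMultiplesOf p type2Twist
type2Twist-∣ p i x = ∣n⇒∣m*n {+ p} (-1ℤ ^ i) {x}

-1^[d*j] : ∀ d j → -1ℤ ^ (d * j) ≡ (-1ℤ ^ d) ^ j
-1^[d*j] d j = sym (ℤ.^-*-assoc -1ℤ d j)

type2Twist-odd : ∀ {d} → ¬ 2 ∣ d → ∀ j x → type2Twist (d * j) x ≡ type2Twist j x
type2Twist-odd {d} 2∤d j x =
  cong (ℤ._* x) (trans (-1^[d*j] d j) (cong (_^ j) (-1^-odd d 2∤d)))

type2Twist-even : ∀ {d} → 2 ∣ d → ∀ j x → type2Twist (d * j) x ≡ type1Twist j x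
type2Twist-even {d} 2∣d j x = trans
  (cong (ℤ._* x) (trans (-1^[d*j] d j) (trans (cong (_^ j) (-1^-even d 2∣d)) (ℤ.^-zeroˡ j))))
  (ℤ.*-identityˡ x)

module _ {p d : ℕ} {α : ℕ → ℤ} (α-in-x^d : IsPolyIn-x^ p α d)
         {τ σ : ℕ → ℤ → ℤ} (τ-on-multiples : ∀ j x → τ (d * j) x ≡ σ j x) where

  reflexibleWith-assoc⁺ : ∀ {n} → ReflexibleWith τ p (d * n) α → ReflexibleWith σ p n (assoc α d)
  reflexibleWith-assoc⁺ {n} (l , l-unit , refl-α) = l , l-unit , λ j j≤n →
    subst₂ (λ k y → l ℤ.* α k ≡ y [mod p ])
      (sym (ℕ.*-distribˡ-∸ d n j)) (τ-on-multiples j _)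
      (refl-α (d * j) (ℕ.*-monoʳ-≤ d j≤n))

  ∣α-off-multiples : ∀ i → ¬ d ∣ i → + p ℤᵤ.∣ α i
  ∣α-off-multiples i d∤i = ¬Unit⇒∣ p (α i) (λ unit → d∤i (α-in-x^d i unit))

  reflexibleWith-assoc⁻ : .{{_ : NonZero d}} → PreservesMultiplesOf p τ →
    ∀ {n} → ReflexibleWith σ p n (assoc α d) → ReflexibleWith τ p (d * n) α
  reflexibleWith-assoc⁻ τ-∣ {n} (l , l-unit , refl-β) = l , l-unit , refl-α
    where
    at-multiple : ∀ j → j ≤ n → l ℤ.* α (d * n ∸ d * j) ≡ τ (d * j) (α (d * j)) [mod p ]
    at-multiple j j≤n = subst₂ (λ k y → l ℤ.* α k ≡ y [mod p ])
      (ℕ.*-distribˡ-∸ d n j) (sym (τ-on-multiples j _)) (refl-β j j≤n)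

    refl-α : ∀ i → i ≤ d * n → l ℤ.* α (d * n ∸ i) ≡ τ i (α i) [mod p ]
    refl-α i i≤dn with d ∣? i
    ... | yes (divides q refl) =
      subst (λ k → l ℤ.* α (d * n ∸ k) ≡ τ k (α k) [mod p ]) (ℕ.*-comm d q)
        (at-multiple q (ℕ.*-cancelˡ-≤ d (subst (_≤ d * n) (ℕ.*-comm q d) i≤dn)))
    ... | no d∤i = ∣m∣n⇒∣m-n {+ p} {l ℤ.* α (d * n ∸ i)} {τ i (α i)}
      (∣n⇒∣m*n {+ p} l {α (d * n ∸ i)} (∣α-off-multiples (d * n ∸ i) d∤dn∸i))
      (τ-∣ i (α i) (∣α-off-multiples i d∤i))
      where
      d∤dn∸i : ¬ d ∣ d * n ∸ i
      d∤dn∸i d∣dn∸i = d∤i (∣m+n∣m⇒∣n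
        (subst (d ∣_) (sym (ℕ.m∸n+n≡m i≤dn)) (m∣m*n n)) d∣dn∸i)

module Reflexibility-assoc {p d m n : ℕ} .{{_ : NonZero d}} {α : ℕ → ℤ}
         (α-in-x^d : IsPolyIn-x^ p α d) (dn≡m : d * n ≡ m) where

  private
    transfer : ∀ {τ σ} → (∀ j x → τ (d * j) x ≡ σ j x) →
      PreservesMultiplesOf p τ → ReflexibleWith τ p m α ⇔ ReflexibleWith σ p n (assoc α d)
    transfer {τ} {σ} τ≡σ τ-∣ rewrite sym dn≡m = mk⇔
      (reflexibleWith-assoc⁺ {p} {d} {α} α-in-x^d {τ} {σ} τ≡σ)
      (reflexibleWith-assoc⁻ {p} {d} {α} α-in-x^d {τ} {σ} τ≡σ τ-∣)

  type1-assoc : Type1 p m α ⇔ Type1 p n (assoc α d)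
  type1-assoc = transfer {type1Twist} (λ _ _ → refl) (type1Twist-∣ p)

  type2-assoc-odd : ¬ 2 ∣ d → Type2 p m α ⇔ Type2 p n (assoc α d)
  type2-assoc-odd 2∤d = transfer {type2Twist} (type2Twist-odd 2∤d) (type2Twist-∣ p)

  type2-assoc-even : 2 ∣ d → Type2 p m α ⇔ Type1 p n (assoc α d)
  type2-assoc-even 2∣d = transfer {type2Twist} (type2Twist-even 2∣d) (type2Twist-∣ p)

  reflexible-assoc-odd : ¬ 2 ∣ d → Reflexible p m α ⇔ Reflexible p n (assoc α d)
  reflexible-assoc-odd 2∤d = type1-assoc ⊎-⇔ type2-assoc-odd 2∤d

  reflexible-assoc-even : 2 ∣ d → Reflexible p m α ⇔ Type1 p n (assoc α d)
  reflexible-assoc-even 2∣d =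
    mk⇔ [ to type1-assoc , to (type2-assoc-even 2∣d) ] (inj₁ ∘ from type1-assoc)

  reflexible⇒reflexible-assoc : Reflexible p m α → Reflexible p n (assoc α d)
  reflexible⇒reflexible-assoc r with 2 ∣? d
  ... | yes 2∣d = inj₁ (to (reflexible-assoc-even 2∣d) r)
  ... | no  2∤d = to (reflexible-assoc-odd 2∤d) r

  reflexible-assoc⇒reflexible : Reflexible p n (assoc α d) →
    ¬ (2 ∣ d × Type2 p n (assoc α d)) → Reflexible p m α
  reflexible-assoc⇒reflexible r exception with 2 ∣? d | r
  ... | no  2∤d | _      = from (reflexible-assoc-odd 2∤d) r
  ... | yes 2∣d | inj₁ t = inj₁ (from type1-assoc t)
  ... | yes 2∣d | inj₂ t = contradiction (2∣d , t) exception

lemma2p7 : (p : ℕ) → Prime p → p ≢ 2 →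
    (m : ℕ) → 1 ≤ m → (α : ℕ → ℤ) → HasDegree p m α →
    (d : ℕ) → (e : IsExp p α d) →
    ((¬ (2 ∣ d)) →
       (Reflexible p m α ⇔ Reflexible p (assocDeg p α d m e) (assoc α d))
       × (Type1 p m α ⇔ Type1 p (assocDeg p α d m e) (assoc α d))
       × (Type2 p m α ⇔ Type2 p (assocDeg p α d m e) (assoc α d)))
    × (2 ∣ d → (Reflexible p m α ⇔ Type1 p (assocDeg p α d m e) (assoc α d)))
    × (Reflexible p m α → WeaklyReflexible p m α d e)
    × (WeaklyReflexible p m α d e →
       ¬ (2 ∣ d × Type2 p (assocDeg p α d m e) (assoc α d)) → Reflexible p m α)
lemma2p7 p _ _ m _ α (αₘ-unit , _) d (d≥1 , α-in-x^d , _) =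
    (λ 2∤d → reflexible-assoc-odd 2∤d , type1-assoc , type2-assoc-odd 2∤d)
  , reflexible-assoc-even
  , reflexible⇒reflexible-assoc
  , reflexible-assoc⇒reflexible
  where
  instance
    d≢0 : NonZero d
    d≢0 = ℕ.>-nonZero d≥1

  open Reflexibility-assoc {α = α} α-in-x^d (m*[n/m]≡n (α-in-x^d m αₘ-unit))
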